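{- Let $A$ be the adjacency matrix of a realization of the directed Chung–Lu random graph with expected degree sequence $(\mathbf{a},\mathbf{b})$. Then for every positive integer $r$, $$\Big(\frac{\mathbf{a}\cdot\mathbf{b}}{S}\Big)^{r}\leq E(\mathrm{trace}(A^{r})).$$
   Context: Directed Chung–Lu model: there are $N$ nodes $1,\dots,N$; $\mathbf{a}=(a_1,\dots,a_N)$ and $\mathbf{b}=(b_1,\dots,b_N)$ are nonnegative integer vectors (expected in-degrees and out-degrees) with $S=\sum_i a_i=\sum_i b_i$ and $\max_{i,j}a_ib_j\le S$. For every ordered pair $(i,j)$ (including $i=j$), the directed edge $i\to j$ is present independently with probability $p_{ij}=\frac{b_ia_j}{S}$; $A$ is the resulting $0/1$ adjacency matrix. $\mathbf{a}\cdot\mathbf{b}=\sum_i a_ib_i$. -}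

module Defs where

open import Data.Nat as ℕ using (ℕ; zero; suc; NonZero)
open import Data.Integer using (+_)
open import Data.Fin using (Fin; zero; suc; _≟_)
open import Relation.Nullary.Decidable using (⌊_⌋)
open import Data.Bool using (Bool; true; false; if_then_else_)
open import Data.List using (List; []; _∷_; _++_; map; concatMap)
open import Data.Rational as ℚ using (ℚ; 0ℚ; 1ℚ)
open import Relation.Binary.PropositionalEquality using (_≡_)

∑ : ∀ {n} → (Fin n → ℕ) → ℕ
∑ {zero}  f = 0
∑ {suc n} f = f zero ℕ.+ ∑ (λ i → f (suc i))

∑ℚ : ∀ {n} → (Fin n → ℚ) → ℚ
∑ℚ {zero}  f = 0ℚ
∑ℚ {suc n} f = f zero ℚ.+ ∑ℚ (λ i → f (suc i))

∏ℚ : ∀ {n} → (Fin n → ℚ) → ℚ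
∏ℚ {zero}  f = 1ℚ
∏ℚ {suc n} f = f zero ℚ.* ∏ℚ (λ i → f (suc i))

sumℚ : List ℚ → ℚ
sumℚ []       = 0ℚ
sumℚ (x ∷ xs) = x ℚ.+ sumℚ xs

_^ℚ_ : ℚ → ℕ → ℚ
x ^ℚ zero  = 1ℚ
x ^ℚ suc r = x ℚ.* (x ^ℚ r)

toℚ : ℕ → ℚ
toℚ n = + n ℚ./ 1

Mat : ℕ → Set
Mat N = Fin N → Fin N → ℕ

_⊗_ : ∀ {N} → Mat N → Mat N → Mat N
(M ⊗ K) i j = ∑ (λ k → M i k ℕ.* K k j)

idMat : ∀ {N} → Mat N
idMat i j = if ⌊ i ≟ j ⌋ then 1 else 0

_^M_ : ∀ {N} → Mat N → ℕ → Mat N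
M ^M zero  = idMat
M ^M suc r = M ⊗ (M ^M r)

trace : ∀ {N} → Mat N → ℕ
trace M = ∑ (λ i → M i i)

Graph : ℕ → Set
Graph N = Fin N → Fin N → Bool

adj : ∀ {N} → Graph N → Mat N
adj G i j = if G i j then 1 else 0

allFuns : ∀ {B : Set} (n : ℕ) → List B → List (Fin n → B)
allFuns zero    bs = (λ ()) ∷ []
allFuns (suc n) bs =
  concatMap (λ b → map (λ f → λ { zero → b ; (suc i) → f i }) (allFuns n bs)) bs

-- all realizations (every 0/1 matrix, each exactly once)
allGraphs : (N : ℕ) → List (Graph N)
allGraphs N = allFuns N (allFuns N (true ∷ false ∷ []))

module ChungLu (N : ℕ) (a b : Fin N → ℕ) {{S≢0 : NonZero (∑ a)}} where

  S : ℕ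
  S = ∑ a

  p : Fin N → Fin N → ℚ
  p i j = + (b i ℕ.* a j) ℚ./ S

  prob : Graph N → ℚ
  prob G = ∏ℚ (λ i → ∏ℚ (λ j → if G i j then p i j else (1ℚ ℚ.- p i j)))

  E : (Graph N → ℚ) → ℚ
  E X = sumℚ (map (λ G → prob G ℚ.* X G) (allGraphs N))

  dot : ℕ
  dot = ∑ (λ i → a i ℕ.* b i)

module Submission where

-- Write P = (p_ij) for the matrix of edge probabilities and A for the
-- adjacency matrix of the random graph.  The proof combines two facts.
--
-- (1) For ANY random digraph with independent edges and p_ij ∈ [0,1],
--     E[(A^r)_ij] ≥ (P^r)_ij.  A walk with edges e_1 … e_r is present with
--     probability ∏ p over its distinct edges, which dominates ∏_k p_{e_k}
--     because p ≤ 1.  Instead of enumerating walks we prove, by induction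
--     on r, the stronger statement
--         Pr[T ⊆ G] · (P^r)_ij ≤ E[ 1{T ⊆ G} · (A^r)_ij ]   for every edge set T,
--     where Pr[T ⊆ G] = ∏_{e ∈ T} p_e; the step adds the first edge i → k
--     of the walk to T.  Summing the diagonal (T = ∅) bounds E[trace(A^r)].
-- (2) The Chung–Lu matrix has rank one, P = u vᵀ with u_i = b_i / S and
--     v_j = a_j, so trace(P^r) = (v · u)^r = (a·b / S)^r.
-- Only max a_i b_j ≤ S (which gives p ≤ 1) is used.

open import Defs
open import Data.Nat as ℕ using (ℕ; suc; NonZero)
open import Data.Fin using (Fin)
open import Data.Integer using (+_)
open import Data.Rational as ℚ using (ℚ)
open import Relation.Binary.PropositionalEquality using (_≡_)

open import Data.Nat.Properties as ℕP using ()
open import Data.Nat.Coprimality using (1-coprimeTo) renaming (sym to coprime-sym)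
open import Data.Integer as ℤ using ()
open import Data.Integer.Properties as ℤP using ()
open import Data.Fin using (zero; suc; _≟_)
open import Data.Fin.Properties using (suc-injective)
open import Data.Rational using (0ℚ; 1ℚ; _+_; _*_; _-_; _≤_; mkℚ)
open import Data.Rational.Properties as ℚP using ()
open import Data.Rational.Solver using (module +-*-Solver)
open import Data.Bool using (Bool; true; false; if_then_else_)
open import Data.List using (List; []; _∷_; _++_; map; concatMap)
open import Data.List.Properties using (map-++; map-cong; map-∘)
open import Data.Vec.Functional using (updateAt)
open import Data.Vec.Functional.Properties using (updateAt-updates; updateAt-minimal)
open import Function using (_∘_)
open import Relation.Binary.PropositionalEquality
  using (refl; sym; trans; cong; cong₂; subst; _≢_; module ≡-Reasoning)
open import Relation.Nullary.Decidable using (yes; no)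
open import Algebra.Bundles using (CommutativeRing)
open import Algebra.Properties.Semiring.Sum (CommutativeRing.semiring ℚP.+-*-commutativeRing)
  using (sum; sum-syntax; sum-cong-≗; sum-replicate-zero; ∑-distrib-+;
         *-distribˡ-sum; *-distribʳ-sum)

open +-*-Solver using (solve; _:=_; _:+_; _:*_; _:-_; con)

-- toℚ n in normal form (denominator 1), from which + and * compute.
toℚ-mkℚ : ∀ n → toℚ n ≡ mkℚ (+ n) 0 (coprime-sym (1-coprimeTo n))
toℚ-mkℚ n = ℚP.normalize-coprime (coprime-sym (1-coprimeTo n))

toℚ-+ : ∀ m n → toℚ (m ℕ.+ n) ≡ toℚ m + toℚ n
toℚ-+ m n = trans (cong (ℚ._/ 1) numerators) (cong₂ _+_ (sym (toℚ-mkℚ m)) (sym (toℚ-mkℚ n)))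
  where
  numerators : + (m ℕ.+ n) ≡ + m ℤ.* + 1 ℤ.+ + n ℤ.* + 1
  numerators = trans (ℤP.pos-+ m n)
    (sym (cong₂ ℤ._+_ (ℤP.*-identityʳ (+ m)) (ℤP.*-identityʳ (+ n))))

toℚ-* : ∀ m n → toℚ (m ℕ.* n) ≡ toℚ m * toℚ n
toℚ-* m n = trans (cong (ℚ._/ 1) (ℤP.pos-* m n)) (cong₂ _*_ (sym (toℚ-mkℚ m)) (sym (toℚ-mkℚ n)))

toℚ-mono : ∀ {m n} → m ℕ.≤ n → toℚ m ≤ toℚ n
toℚ-mono {m} {n} m≤n rewrite toℚ-mkℚ m | toℚ-mkℚ n =
  ℚ.*≤* (ℤP.*-monoʳ-≤-nonNeg (+ 1) (ℤ.+≤+ m≤n))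

toℚ-∑ : ∀ {n} (f : Fin n → ℕ) → toℚ (∑ f) ≡ ∑[ i < n ] toℚ (f i)
toℚ-∑ {ℕ.zero} f = refl
toℚ-∑ {suc n} f = trans (toℚ-+ (f zero) _) (cong (_+_ (toℚ (f zero))) (toℚ-∑ (f ∘ suc)))

/-as-* : ∀ x n .{{_ : NonZero n}} → + x ℚ./ n ≡ toℚ x * (+ 1 ℚ./ n)
/-as-* x (suc m) = trans (ℚP./-cong (sym (ℤP.*-identityʳ (+ x))) (sym (ℕP.*-identityˡ (suc m))))
  (cong₂ _*_ (sym (toℚ-mkℚ x)) (sym (ℚP.normalize-coprime (1-coprimeTo (suc m)))))

toℚ-*-reciprocal : ∀ n .{{_ : NonZero n}} → toℚ n * (+ 1 ℚ./ n) ≡ 1ℚ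
toℚ-*-reciprocal (suc m) =
  trans (cong₂ _*_ (toℚ-mkℚ (suc m)) (ℚP.normalize-coprime (1-coprimeTo (suc m))))
        (ℚP.*-inverseʳ (mkℚ (+ suc m) 0 (coprime-sym (1-coprimeTo (suc m)))))

-- Sign conditions for products, with the nonnegativity hypotheses given
-- explicitly rather than as instances.

nonNeg-* : ∀ {x y} → 0ℚ ≤ x → 0ℚ ≤ y → 0ℚ ≤ x * y
nonNeg-* {x} {y} 0≤x 0≤y = ℚP.nonNegative⁻¹ (x * y)
  {{ℚP.nonNeg*nonNeg⇒nonNeg x {{ℚ.nonNegative 0≤x}} y {{ℚ.nonNegative 0≤y}}}}

*-monoʳ-≤ : ∀ {x y z} → 0ℚ ≤ z → x ≤ y → x * z ≤ y * z
*-monoʳ-≤ {z = z} 0≤z = ℚP.*-monoʳ-≤-nonNeg z {{ℚ.nonNegative 0≤z}}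

sum-mono : ∀ {n} {f g : Fin n → ℚ} → (∀ i → f i ≤ g i) → sum f ≤ sum g
sum-mono {ℕ.zero} f≤g = ℚP.≤-refl
sum-mono {suc n}  f≤g = ℚP.+-mono-≤ (f≤g zero) (sum-mono (f≤g ∘ suc))

sum-nonNeg : ∀ {n} {f : Fin n → ℚ} → (∀ i → 0ℚ ≤ f i) → 0ℚ ≤ sum f
sum-nonNeg {n} {f} 0≤f = subst (_≤ sum f) (sum-replicate-zero n) (sum-mono 0≤f)

idMat-suc : ∀ {n} (k j : Fin n) → idMat (suc k) (suc j) ≡ idMat k j
idMat-suc k j with k ≟ j
... | yes _ = refl
... | no _  = refl

sum-idMat : ∀ {n} (f : Fin n → ℚ) j → ∑[ k < n ] (f k * toℚ (idMat k j)) ≡ f j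
sum-idMat {suc n} f zero = begin
  f zero * 1ℚ + ∑[ k < n ] (f (suc k) * 0ℚ)  ≡⟨ cong₂ _+_ (ℚP.*-identityʳ (f zero)) vanish ⟩
  f zero + 0ℚ                                ≡⟨ ℚP.+-identityʳ (f zero) ⟩
  f zero                                     ∎
  where
  open ≡-Reasoning
  vanish : ∑[ k < n ] (f (suc k) * 0ℚ) ≡ 0ℚ
  vanish = trans (sum-cong-≗ (ℚP.*-zeroʳ ∘ f ∘ suc)) (sum-replicate-zero n)
sum-idMat {suc n} f (suc j) = begin
  f zero * 0ℚ + ∑[ k < n ] (f (suc k) * toℚ (idMat (suc k) (suc j)))
    ≡⟨ cong₂ _+_ (ℚP.*-zeroʳ (f zero)) (sum-cong-≗ (λ k → cong (λ d → f (suc k) * toℚ d) (idMat-suc k j))) ⟩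
  0ℚ + ∑[ k < n ] (f (suc k) * toℚ (idMat k j))
    ≡⟨ ℚP.+-identityˡ _ ⟩
  ∑[ k < n ] (f (suc k) * toℚ (idMat k j))
    ≡⟨ sum-idMat (f ∘ suc) j ⟩
  f (suc j) ∎
  where open ≡-Reasoning

∏-cong : ∀ {n} {f g : Fin n → ℚ} → (∀ i → f i ≡ g i) → ∏ℚ f ≡ ∏ℚ g
∏-cong {ℕ.zero} f≡g = refl
∏-cong {suc n}  f≡g = cong₂ _*_ (f≡g zero) (∏-cong (f≡g ∘ suc))

∏-one : ∀ n → ∏ℚ {n} (λ _ → 1ℚ) ≡ 1ℚ
∏-one ℕ.zero    = refl
∏-one (suc n) = trans (ℚP.*-identityˡ _) (∏-one n)

∏-nonNeg : ∀ {n} {f : Fin n → ℚ} → (∀ i → 0ℚ ≤ f i) → 0ℚ ≤ ∏ℚ f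
∏-nonNeg {ℕ.zero} _   = ℚP.nonNegative⁻¹ 1ℚ
∏-nonNeg {suc n}  0≤f = nonNeg-* (0≤f zero) (∏-nonNeg (0≤f ∘ suc))

∏-distrib-* : ∀ {n} (f g : Fin n → ℚ) → ∏ℚ f * ∏ℚ g ≡ ∏ℚ (λ i → f i * g i)
∏-distrib-* {ℕ.zero} f g = refl
∏-distrib-* {suc n}  f g =
  trans (interchange (f zero) _ (g zero) _) (cong (f zero * g zero *_) (∏-distrib-* (f ∘ suc) (g ∘ suc)))
  where
  interchange : ∀ a b c d → (a * b) * (c * d) ≡ (a * c) * (b * d)
  interchange = solve 4 (λ a b c d → (a :* b) :* (c :* d) := (a :* c) :* (b :* d)) refl

∏-update : ∀ {n} (f g : Fin n → ℚ) k c → g k ≡ c * f k → (∀ i → i ≢ k → g i ≡ f i) →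
           ∏ℚ g ≡ c * ∏ℚ f
∏-update {suc n} f g zero c changed same =
  trans (cong₂ _*_ changed (∏-cong (λ i → same (suc i) λ ())))
        (ℚP.*-assoc c (f zero) _)
∏-update {suc n} f g (suc k) c changed same =
  trans (cong₂ _*_ (same zero λ ())
          (∏-update (f ∘ suc) (g ∘ suc) k c changed (λ i i≢k → same (suc i) (i≢k ∘ suc-injective))))
        (swap (f zero) c _)
  where
  swap : ∀ x y z → x * (y * z) ≡ y * (x * z)
  swap = solve 3 (λ x y z → x :* (y :* z) := y :* (x :* z)) refl

sumℚ-cong : ∀ {B : Set} {f g : B → ℚ} → (∀ x → f x ≡ g x) → ∀ xs → sumℚ (map f xs) ≡ sumℚ (map g xs)
sumℚ-cong f≡g xs = cong sumℚ (map-cong f≡g xs)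

sumℚ-++ : ∀ xs ys → sumℚ (xs ++ ys) ≡ sumℚ xs + sumℚ ys
sumℚ-++ []       ys = sym (ℚP.+-identityˡ _)
sumℚ-++ (x ∷ xs) ys = trans (cong (_+_ x) (sumℚ-++ xs ys)) (sym (ℚP.+-assoc x _ _))

sumℚ-concatMap : ∀ {A B : Set} (h : B → ℚ) (k : A → List B) xs →
  sumℚ (map h (concatMap k xs)) ≡ sumℚ (map (λ x → sumℚ (map h (k x))) xs)
sumℚ-concatMap h k []       = refl
sumℚ-concatMap h k (x ∷ xs) = begin
  sumℚ (map h (k x ++ concatMap k xs))              ≡⟨ cong sumℚ (map-++ h (k x) _) ⟩
  sumℚ (map h (k x) ++ map h (concatMap k xs))      ≡⟨ sumℚ-++ (map h (k x)) _ ⟩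
  sumℚ (map h (k x)) + sumℚ (map h (concatMap k xs)) ≡⟨ cong (_+_ (sumℚ (map h (k x)))) (sumℚ-concatMap h k xs) ⟩
  sumℚ (map h (k x)) + sumℚ (map (λ x → sumℚ (map h (k x))) xs) ∎
  where open ≡-Reasoning

sumℚ-*ˡ : ∀ {B : Set} c (f : B → ℚ) xs → sumℚ (map (λ x → c * f x) xs) ≡ c * sumℚ (map f xs)
sumℚ-*ˡ c f []       = sym (ℚP.*-zeroʳ c)
sumℚ-*ˡ c f (x ∷ xs) = trans (cong (_+_ (c * f x)) (sumℚ-*ˡ c f xs)) (sym (ℚP.*-distribˡ-+ c _ _))

sumℚ-*ʳ : ∀ {B : Set} c (f : B → ℚ) xs → sumℚ (map (λ x → f x * c) xs) ≡ sumℚ (map f xs) * c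
sumℚ-*ʳ c f []       = sym (ℚP.*-zeroˡ c)
sumℚ-*ʳ c f (x ∷ xs) = trans (cong (_+_ (f x * c)) (sumℚ-*ʳ c f xs)) (sym (ℚP.*-distribʳ-+ c (f x) _))

sumℚ-∑ : ∀ {B : Set} {n} (F : Fin n → B → ℚ) xs →
  sumℚ (map (λ x → ∑[ k < n ] F k x) xs) ≡ ∑[ k < n ] sumℚ (map (F k) xs)
sumℚ-∑ {n = n} F []       = sym (sum-replicate-zero n)
sumℚ-∑ {n = n} F (x ∷ xs) =
  trans (cong (_+_ (∑[ k < n ] F k x)) (sumℚ-∑ F xs)) (sym (∑-distrib-+ (λ k → F k x) _))

sum-allFuns-∏ : ∀ {B : Set} n (bs : List B) (h : Fin n → B → ℚ) →
  sumℚ (map (λ g → ∏ℚ (λ i → h i (g i))) (allFuns n bs)) ≡ ∏ℚ (λ i → sumℚ (map (h i) bs))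
sum-allFuns-∏ ℕ.zero  bs h = refl
sum-allFuns-∏ {B} (suc n) bs h =
  trans (sumℚ-concatMap (λ g → ∏ℚ (λ i → h i (g i))) _ bs)
  (trans (sumℚ-cong (λ b →
            -- functions with first value b: factor out h₀(b), recurse on the rest
            trans (cong sumℚ (sym (map-∘ (allFuns n bs))))
            (trans (sumℚ-*ˡ (h zero b) rest (allFuns n bs))
                   (cong (h zero b *_) (sum-allFuns-∏ n bs (h ∘ suc))))) bs)
         (sumℚ-*ʳ _ (h zero) bs))
  where
  rest : (Fin n → B) → ℚ
  rest g = ∏ℚ (λ i → h (suc i) (g i))

power : ∀ {N} → (Fin N → Fin N → ℚ) → ℕ → Fin N → Fin N → ℚ
power P ℕ.zero      i j = toℚ (idMat i j)
power {N} P (suc r) i j = ∑[ k < N ] (P i k * power P r k j)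

power-nonNeg : ∀ {N} {P : Fin N → Fin N → ℚ} → (∀ i j → 0ℚ ≤ P i j) → ∀ r i j → 0ℚ ≤ power P r i j
power-nonNeg 0≤P ℕ.zero  i j = toℚ-mono {n = idMat i j} ℕ.z≤n
power-nonNeg 0≤P (suc r) i j = sum-nonNeg (λ k → nonNeg-* (0≤P i k) (power-nonNeg 0≤P r k j))

-- A rank-one matrix P = u vᵀ satisfies P² = ρ P with ρ = v · u = trace P,
-- hence P^(r+1) = ρ^r P and trace P^(r+1) = ρ^(r+1).
module RankOne {N} (P : Fin N → Fin N → ℚ) (u v : Fin N → ℚ) (P≡uv : ∀ i j → P i j ≡ u i * v j) where

  ρ : ℚ
  ρ = ∑[ k < N ] (u k * v k)

  square : ∀ i j → ∑[ k < N ] (P i k * P k j) ≡ P i j * ρ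
  square i j = begin
    ∑[ k < N ] (P i k * P k j)               ≡⟨ sum-cong-≗ (λ k → trans (cong₂ _*_ (P≡uv i k) (P≡uv k j))
                                                                       (regroup (u i) (v k) (u k) (v j))) ⟩
    ∑[ k < N ] ((u i * v j) * (u k * v k))   ≡⟨ *-distribˡ-sum (u i * v j) (λ k → u k * v k) ⟨
    (u i * v j) * ρ                          ≡⟨ cong (_* ρ) (P≡uv i j) ⟨
    P i j * ρ                                ∎
    where
    open ≡-Reasoning
    regroup : ∀ ui vk uk vj → (ui * vk) * (uk * vj) ≡ (ui * vj) * (uk * vk)
    regroup = solve 4 (λ ui vk uk vj → (ui :* vk) :* (uk :* vj) := (ui :* vj) :* (uk :* vk)) refl

  power-suc : ∀ r i j → power P (suc r) i j ≡ P i j * ρ ^ℚ r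
  power-suc ℕ.zero  i j = trans (sum-idMat (P i) j) (sym (ℚP.*-identityʳ (P i j)))
  power-suc (suc r) i j = begin
    ∑[ k < N ] (P i k * power P (suc r) k j)   ≡⟨ sum-cong-≗ (λ k → trans (cong (P i k *_) (power-suc r k j))
                                                                         (sym (ℚP.*-assoc (P i k) (P k j) _))) ⟩
    ∑[ k < N ] ((P i k * P k j) * ρ ^ℚ r)      ≡⟨ *-distribʳ-sum (ρ ^ℚ r) (λ k → P i k * P k j) ⟨
    ∑[ k < N ] (P i k * P k j) * ρ ^ℚ r        ≡⟨ cong (_* ρ ^ℚ r) (square i j) ⟩
    (P i j * ρ) * ρ ^ℚ r                       ≡⟨ ℚP.*-assoc (P i j) ρ (ρ ^ℚ r) ⟩
    P i j * ρ ^ℚ suc r                         ∎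
    where open ≡-Reasoning

  trace-power : ∀ r → ∑[ i < N ] power P (suc r) i i ≡ ρ ^ℚ suc r
  trace-power r = begin
    ∑[ i < N ] power P (suc r) i i   ≡⟨ sum-cong-≗ (λ i → power-suc r i i) ⟩
    ∑[ i < N ] (P i i * ρ ^ℚ r)      ≡⟨ *-distribʳ-sum (ρ ^ℚ r) (λ i → P i i) ⟨
    ∑[ i < N ] P i i * ρ ^ℚ r        ≡⟨ cong (_* ρ ^ℚ r) (sum-cong-≗ (λ i → P≡uv i i)) ⟩
    ρ ^ℚ suc r                       ∎
    where open ≡-Reasoning

-- Edge sets.  A graph G : Graph N doubles as a set of directed edges.

∏∏ : ∀ {N} → (Fin N → Fin N → ℚ) → ℚ
∏∏ f = ∏ℚ (λ i → ∏ℚ (λ j → f i j))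

∏∏-nonNeg : ∀ {N} {f : Fin N → Fin N → ℚ} → (∀ i j → 0ℚ ≤ f i j) → 0ℚ ≤ ∏∏ f
∏∏-nonNeg 0≤f = ∏-nonNeg (λ i → ∏-nonNeg (0≤f i))

∏∏-one : ∀ {N} → ∏∏ {N} (λ _ _ → 1ℚ) ≡ 1ℚ
∏∏-one {N} = trans (∏-cong {N} (λ _ → ∏-one N)) (∏-one N)

∏∏-distrib-* : ∀ {N} (f g : Fin N → Fin N → ℚ) → ∏∏ f * ∏∏ g ≡ ∏∏ (λ i j → f i j * g i j)
∏∏-distrib-* f g = trans (∏-distrib-* (λ i → ∏ℚ (f i)) (λ i → ∏ℚ (g i))) (∏-cong (λ i → ∏-distrib-* (f i) (g i)))

insertEdge : ∀ {N} → Graph N → Fin N → Fin N → Graph N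
insertEdge T i j = updateAt T i (λ row → updateAt row j (λ _ → true))

∏∏-insertEdge : ∀ {N} (φ : Fin N → Fin N → Bool → ℚ) (T : Graph N) i j c →
  φ i j true ≡ c * φ i j (T i j) →
  ∏∏ (λ k l → φ k l (insertEdge T i j k l)) ≡ c * ∏∏ (λ k l → φ k l (T k l))
∏∏-insertEdge φ T i j c factor = ∏-update _ _ i c rowᵢ otherRows
  where
  newRow : insertEdge T i j i ≡ updateAt (T i) j (λ _ → true)
  newRow = updateAt-updates i T
  rowᵢ : ∏ℚ (λ l → φ i l (insertEdge T i j i l)) ≡ c * ∏ℚ (λ l → φ i l (T i l))
  rowᵢ rewrite newRow = ∏-update _ _ j c
    (trans (cong (φ i j) (updateAt-updates j (T i))) factor)
    (λ l l≢j → cong (φ i l) (updateAt-minimal l j (T i) l≢j))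
  otherRows : ∀ k → k ≢ i → ∏ℚ (λ l → φ k l (insertEdge T i j k l)) ≡ ∏ℚ (λ l → φ k l (T k l))
  otherRows k k≢i = ∏-cong (λ l → cong (λ row → φ k l (row l)) (updateAt-minimal k i T k≢i))

module RandomDigraph (N : ℕ) (p : Fin N → Fin N → ℚ) where

  edgeProb : Fin N → Fin N → Bool → ℚ
  edgeProb i j x = if x then p i j else 1ℚ - p i j

  prob : Graph N → ℚ
  prob G = ∏∏ (λ i j → edgeProb i j (G i j))

  E : (Graph N → ℚ) → ℚ
  E X = sumℚ (map (λ G → prob G * X G) (allGraphs N))

  E-cong : ∀ {X Y : Graph N → ℚ} → (∀ G → X G ≡ Y G) → E X ≡ E Y
  E-cong X≡Y = sumℚ-cong (λ G → cong (prob G *_) (X≡Y G)) (allGraphs N)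

  E-*ʳ : ∀ X c → E (λ G → X G * c) ≡ E X * c
  E-*ʳ X c = trans (sumℚ-cong (λ G → sym (ℚP.*-assoc (prob G) (X G) c)) (allGraphs N))
                   (sumℚ-*ʳ c (λ G → prob G * X G) (allGraphs N))

  E-∑ : ∀ (F : Fin N → Graph N → ℚ) → E (λ G → ∑[ k < N ] F k G) ≡ ∑[ k < N ] E (F k)
  E-∑ F = trans (sumℚ-cong (λ G → *-distribˡ-sum (prob G) (λ k → F k G)) (allGraphs N))
                (sumℚ-∑ (λ k G → prob G * F k G) (allGraphs N))

  edgeMean : Fin N → Fin N → (Bool → ℚ) → ℚ
  edgeMean i j φ = sumℚ (map (λ x → edgeProb i j x * φ x) (true ∷ false ∷ []))

  E-product : ∀ (f : Fin N → Fin N → Bool → ℚ) →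
    E (λ G → ∏∏ (λ i j → f i j (G i j))) ≡ ∏∏ (λ i j → edgeMean i j (f i j))
  E-product f = begin
    E (λ G → ∏∏ (λ i j → f i j (G i j)))
      ≡⟨ sumℚ-cong (λ G → ∏∏-distrib-* (λ i j → edgeProb i j (G i j)) (λ i j → f i j (G i j))) (allGraphs N) ⟩
    sumℚ (map (λ G → ∏ℚ (λ i → ∏ℚ (λ j → w i j (G i j)))) (allGraphs N))
      ≡⟨ sum-allFuns-∏ N _ (λ i row → ∏ℚ (λ j → w i j (row j))) ⟩
    ∏ℚ (λ i → sumℚ (map (λ row → ∏ℚ (λ j → w i j (row j))) (allFuns N (true ∷ false ∷ []))))
      ≡⟨ ∏-cong (λ i → sum-allFuns-∏ N _ (w i)) ⟩
    ∏∏ (λ i j → edgeMean i j (f i j)) ∎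
    where
    open ≡-Reasoning
    w : Fin N → Fin N → Bool → ℚ
    w i j x = edgeProb i j x * f i j x

  -- the indicator 1{T ⊆ G} = ∏_{(i,j) ∈ T} A_ij
  includes : Graph N → Graph N → ℚ
  includes T G = ∏∏ (λ i j → if T i j then toℚ (adj G i j) else 1ℚ)

  -- Pr[T ⊆ G] = ∏_{(i,j) ∈ T} p_ij
  weight : Graph N → ℚ
  weight T = ∏∏ (λ i j → if T i j then p i j else 1ℚ)

  E-includes : ∀ T → E (includes T) ≡ weight T
  E-includes T = trans (E-product (λ i j x → if T i j then toℚ (if x then 1 else 0) else 1ℚ))
                       (∏-cong (λ i → ∏-cong (λ j → singleEdge i j (T i j))))
    where
    singleEdge : ∀ i j t → edgeMean i j (λ x → if t then toℚ (if x then 1 else 0) else 1ℚ)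
                           ≡ (if t then p i j else 1ℚ)
    singleEdge i j true  = solve 1 (λ q → q :* con 1ℚ :+ ((con 1ℚ :- q) :* con 0ℚ :+ con 0ℚ) := q) refl (p i j)
    singleEdge i j false = solve 1 (λ q → q :* con 1ℚ :+ ((con 1ℚ :- q) :* con 1ℚ :+ con 0ℚ) := con 1ℚ) refl (p i j)

  -- Inserting i → j into T multiplies the indicator by A_ij (an idempotent 0/1 value).
  includes-insert : ∀ T i j G → includes (insertEdge T i j) G ≡ toℚ (adj G i j) * includes T G
  includes-insert T i j G = ∏∏-insertEdge (λ k l t → if t then toℚ (adj G k l) else 1ℚ) T i j
                              (toℚ (adj G i j)) (idempotent (T i j) (G i j))
    where
    idempotent : ∀ t x → toℚ (if x then 1 else 0)
                         ≡ toℚ (if x then 1 else 0) * (if t then toℚ (if x then 1 else 0) else 1ℚ)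
    idempotent true  true  = refl
    idempotent true  false = refl
    idempotent false x     = sym (ℚP.*-identityʳ _)

  first-step : ∀ T i j r G →
    ∑[ k < N ] (includes (insertEdge T i k) G * toℚ ((adj G ^M r) k j))
    ≡ includes T G * toℚ ((adj G ^M suc r) i j)
  first-step T i j r G = begin
    ∑[ k < N ] (includes (insertEdge T i k) G * X k)
      ≡⟨ sum-cong-≗ (λ k → trans (cong (_* X k) (includes-insert T i k G))
                                 (shuffle (toℚ (adj G i k)) (includes T G) (X k))) ⟩
    ∑[ k < N ] (includes T G * (toℚ (adj G i k) * X k))
      ≡⟨ *-distribˡ-sum (includes T G) (λ k → toℚ (adj G i k) * X k) ⟨
    includes T G * ∑[ k < N ] (toℚ (adj G i k) * X k)
      ≡⟨ cong (includes T G *_) (trans (toℚ-∑ (λ k → adj G i k ℕ.* (adj G ^M r) k j))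
                                       (sum-cong-≗ (λ k → toℚ-* (adj G i k) _))) ⟨
    includes T G * toℚ ((adj G ^M suc r) i j) ∎
    where
    open ≡-Reasoning
    X : Fin N → ℚ
    X k = toℚ ((adj G ^M r) k j)
    shuffle : ∀ a c x → (a * c) * x ≡ c * (a * x)
    shuffle = solve 3 (λ a c x → (a :* c) :* x := c :* (a :* x)) refl

  module _ (0≤p : ∀ i j → 0ℚ ≤ p i j) (p≤1 : ∀ i j → p i j ≤ 1ℚ) where

    weight-nonNeg : ∀ T → 0ℚ ≤ weight T
    weight-nonNeg T = ∏∏-nonNeg (λ i j → factor-nonNeg i j (T i j))
      where
      factor-nonNeg : ∀ i j t → 0ℚ ≤ (if t then p i j else 1ℚ)
      factor-nonNeg i j true  = 0≤p i j
      factor-nonNeg i j false = ℚP.nonNegative⁻¹ 1ℚ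

    -- Inserting i → j into T multiplies Pr[T ⊆ G] by p_ij if the edge is new
    -- and by 1 ≥ p_ij otherwise.
    weight-insert : ∀ T i j → p i j * weight T ≤ weight (insertEdge T i j)
    weight-insert T i j = subst (p i j * weight T ≤_)
      (sym (∏∏-insertEdge (λ k l t → if t then p k l else 1ℚ) T i j (gain (T i j)) (new-factor (T i j))))
      (*-monoʳ-≤ (weight-nonNeg T) (p≤gain (T i j)))
      where
      gain : Bool → ℚ
      gain t = if t then 1ℚ else p i j
      new-factor : ∀ t → p i j ≡ gain t * (if t then p i j else 1ℚ)
      new-factor true  = sym (ℚP.*-identityˡ (p i j))
      new-factor false = sym (ℚP.*-identityʳ (p i j))
      p≤gain : ∀ t → p i j ≤ gain t
      p≤gain true  = p≤1 i j
      p≤gain false = ℚP.≤-refl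

    walk-bound : ∀ r T i j → weight T * power p r i j ≤ E (λ G → includes T G * toℚ ((adj G ^M r) i j))
    walk-bound ℕ.zero T i j = ℚP.≤-reflexive (sym (begin
      E (λ G → includes T G * toℚ (idMat i j)) ≡⟨ E-*ʳ (includes T) (toℚ (idMat i j)) ⟩
      E (includes T) * toℚ (idMat i j)         ≡⟨ cong (_* toℚ (idMat i j)) (E-includes T) ⟩
      weight T * toℚ (idMat i j)               ∎))
      where open ≡-Reasoning
    walk-bound (suc r) T i j = begin
      weight T * ∑[ k < N ] (p i k * power p r k j)
        ≡⟨ trans (*-distribˡ-sum (weight T) (λ k → p i k * power p r k j))
                 (sum-cong-≗ (λ k → reorder (weight T) (p i k) (power p r k j))) ⟩
      ∑[ k < N ] ((p i k * weight T) * power p r k j)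
        ≤⟨ sum-mono (λ k → *-monoʳ-≤ (power-nonNeg 0≤p r k j) (weight-insert T i k)) ⟩
      ∑[ k < N ] (weight (insertEdge T i k) * power p r k j)
        ≤⟨ sum-mono (λ k → walk-bound r (insertEdge T i k) k j) ⟩
      ∑[ k < N ] E (λ G → includes (insertEdge T i k) G * X r k j G)
        ≡⟨ E-∑ (λ k G → includes (insertEdge T i k) G * X r k j G) ⟨
      E (λ G → ∑[ k < N ] (includes (insertEdge T i k) G * X r k j G))
        ≡⟨ E-cong (first-step T i j r) ⟩
      E (λ G → includes T G * X (suc r) i j G) ∎
      where
      open ℚP.≤-Reasoning
      X : ℕ → Fin N → Fin N → Graph N → ℚ
      X n k l G = toℚ ((adj G ^M n) k l)
      reorder : ∀ w q x → w * (q * x) ≡ (q * w) * x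
      reorder = solve 3 (λ w q x → w :* (q :* x) := (q :* w) :* x) refl

    -- The case T = ∅ (where both the weight and the indicator are the empty
    -- product 1): E[(A^r)_ij] ≥ (P^r)_ij.
    entry-bound : ∀ r i j → power p r i j ≤ E (λ G → toℚ ((adj G ^M r) i j))
    entry-bound r i j = begin
      power p r i j                  ≡⟨ trans (sym (ℚP.*-identityˡ _)) (cong (_* power p r i j) (sym (∏∏-one {N}))) ⟩
      weight ∅ * power p r i j       ≤⟨ walk-bound r ∅ i j ⟩
      E (λ G → includes ∅ G * X G)  ≡⟨ E-cong (λ G → trans (cong (_* X G) (∏∏-one {N})) (ℚP.*-identityˡ (X G))) ⟩
      E X                            ∎
      where
      open ℚP.≤-Reasoning
      ∅ : Graph N
      ∅ _ _ = false
      X : Graph N → ℚ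
      X G = toℚ ((adj G ^M r) i j)

    trace-bound : ∀ r → ∑[ i < N ] power p r i i ≤ E (λ G → toℚ (trace (adj G ^M r)))
    trace-bound r = begin
      ∑[ i < N ] power p r i i                          ≤⟨ sum-mono (λ i → entry-bound r i i) ⟩
      ∑[ i < N ] E (λ G → toℚ ((adj G ^M r) i i))       ≡⟨ E-∑ (λ i G → toℚ ((adj G ^M r) i i)) ⟨
      E (λ G → ∑[ i < N ] toℚ ((adj G ^M r) i i))       ≡⟨ E-cong (λ G → toℚ-∑ (λ i → (adj G ^M r) i i)) ⟨
      E (λ G → toℚ (trace (adj G ^M r)))                ∎
      where open ℚP.≤-Reasoning

module ChungLuRankOne (N : ℕ) (a b : Fin N → ℕ) {{S≢0 : NonZero (∑ a)}} where
  open ChungLu N a b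

  s : ℚ
  s = + 1 ℚ./ S

  u v : Fin N → ℚ
  u i = toℚ (b i) * s
  v j = toℚ (a j)

  p-rank-one : ∀ i j → p i j ≡ u i * v j
  p-rank-one i j = begin
    + (b i ℕ.* a j) ℚ./ S          ≡⟨ /-as-* (b i ℕ.* a j) S ⟩
    toℚ (b i ℕ.* a j) * s          ≡⟨ cong (_* s) (toℚ-* (b i) (a j)) ⟩
    (toℚ (b i) * toℚ (a j)) * s    ≡⟨ swap (toℚ (b i)) (toℚ (a j)) s ⟩
    (toℚ (b i) * s) * toℚ (a j)    ∎
    where
    open ≡-Reasoning
    swap : ∀ x y z → (x * y) * z ≡ (x * z) * y
    swap = solve 3 (λ x y z → (x :* y) :* z := (x :* z) :* y) refl

  dot-rank-one : + dot ℚ./ S ≡ ∑[ k < N ] (u k * v k)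
  dot-rank-one = begin
    + dot ℚ./ S                                     ≡⟨ /-as-* dot S ⟩
    toℚ dot * s                                     ≡⟨ cong (_* s) (trans (toℚ-∑ (λ k → a k ℕ.* b k))
                                                                         (sum-cong-≗ (λ k → toℚ-* (a k) (b k)))) ⟩
    ∑[ k < N ] (toℚ (a k) * toℚ (b k)) * s          ≡⟨ *-distribʳ-sum s (λ k → toℚ (a k) * toℚ (b k)) ⟩
    ∑[ k < N ] ((toℚ (a k) * toℚ (b k)) * s)        ≡⟨ sum-cong-≗ (λ k → rearrange (toℚ (a k)) (toℚ (b k)) s) ⟩
    ∑[ k < N ] (u k * v k)                          ∎
    where
    open ≡-Reasoning
    rearrange : ∀ x y z → (x * y) * z ≡ (y * z) * x
    rearrange = solve 3 (λ x y z → (x :* y) :* z := (y :* z) :* x) refl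

  p-nonNeg : ∀ i j → 0ℚ ≤ p i j
  p-nonNeg i j = ℚP.nonNegative⁻¹ (p i j) {{ℚP.normalize-nonNeg (b i ℕ.* a j) S}}

  p≤1 : (∀ i j → a i ℕ.* b j ℕ.≤ S) → ∀ i j → p i j ≤ 1ℚ
  p≤1 ab≤S i j = begin
    p i j                    ≡⟨ /-as-* (b i ℕ.* a j) S ⟩
    toℚ (b i ℕ.* a j) * s    ≤⟨ *-monoʳ-≤ s-nonNeg (toℚ-mono (subst (ℕ._≤ S) (ℕP.*-comm (a j) (b i)) (ab≤S j i))) ⟩
    toℚ S * s                ≡⟨ toℚ-*-reciprocal S ⟩
    1ℚ                       ∎
    where
    open ℚP.≤-Reasoning
    s-nonNeg : 0ℚ ≤ s
    s-nonNeg = ℚP.nonNegative⁻¹ s {{ℚP.normalize-nonNeg 1 S}}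

-- (a·b / S)^r = trace P^r ≤ E[trace A^r]; the Chung–Lu expectation is the
-- independent-edge expectation for the matrix ChungLu.p.
corollary1 : (N : ℕ) (a b : Fin N → ℕ) {{S≢0 : NonZero (∑ a)}} →
    ∑ a ≡ ∑ b →
    (∀ i j → a i ℕ.* b j ℕ.≤ ∑ a) →
    (r : ℕ) → 1 ℕ.≤ r →
    ((+ ChungLu.dot N a b) ℚ./ ∑ a) ^ℚ r
      ℚ.≤ ChungLu.E N a b (λ G → toℚ (trace (adj G ^M r)))
corollary1 N a b _ ab≤S (suc r) _ = begin
  (+ dot ℚ./ S) ^ℚ suc r                    ≡⟨ cong (_^ℚ suc r) dot-rank-one ⟩
  ρ ^ℚ suc r                                ≡⟨ trace-power r ⟨
  ∑[ i < N ] power p (suc r) i i            ≤⟨ trace-bound p-nonNeg (p≤1 ab≤S) (suc r) ⟩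
  E (λ G → toℚ (trace (adj G ^M suc r)))    ∎
  where
  open ℚP.≤-Reasoning
  open ChungLu N a b using (p; dot; S)
  open ChungLuRankOne N a b
  open RankOne p u v p-rank-one
  open RandomDigraph N p
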